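{- Let $n$ be an odd composite positive integer. For $k=1,2,\ldots$ define $a_k(x)=\sum_{m=0}^{k} J(k-m,n)\,x^m$, where $J(a,n)$ is the Jacobi symbol, and let $H_n(x)=\det\big[a_{i+j-1}(x)\big]_{1\le i,j\le n}$. Then $H_n(x)$ is identically zero.
   Context: For an odd integer $m$ with prime factorization $m=p_1^{e_1}\cdots p_k^{e_k}$, the Jacobi symbol is $J(a,m)=\prod_{i}\left(\frac{a}{p_i}\right)^{e_i}$, where for a prime $p$ the Legendre symbol $\left(\frac{a}{p}\right)$ is $0$ if $p\mid a$, $1$ if $a$ is a nonzero quadratic residue mod $p$, and $-1$ otherwise. -}

module Defs where

open import Data.Nat as ℕ using (ℕ; zero; suc; _∸_; _≟_)
open import Data.Nat.DivMod using (_%_; _/_)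
open import Data.Nat.Divisibility using (_∣?_)
open import Data.Nat.Primality using (prime?)
open import Data.Integer as ℤ using (ℤ; +_; -_; _*_; _+_; _^_)
open import Data.Fin using (Fin; zero; suc; toℕ; punchIn)
open import Data.List using (upTo)
open import Data.List.Relation.Unary.Any using (any?)
open import Relation.Nullary using (yes; no; does)
open import Data.Bool using (if_then_else_)

-- Legendre symbol (a / p) for p = q + 2, following the definition:
-- 0 if p ∣ a; 1 if a is a nonzero quadratic residue mod p; -1 otherwise.
legendre : ℕ → ℕ → ℤ
legendre a q with suc (suc q) ∣? a
... | yes _ = + 0
... | no _ with any? (λ y → (y ℕ.* y) % suc (suc q) ≟ a % suc (suc q)) (upTo (suc (suc q)))
...   | yes _ = + 1
...   | no _  = - (+ 1)

-- p-adic valuation v_p(m) for p = q + 2 (v_p(0) := 0; fuel suffices since v_p(m) ≤ m).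
valFuel : ℕ → ℕ → ℕ → ℕ
valFuel zero    q m = 0
valFuel (suc f) q zero = 0
valFuel (suc f) q (suc m) with suc (suc q) ∣? suc m
... | yes _ = suc (valFuel f q (suc m / suc (suc q)))
... | no _  = 0

val : ℕ → ℕ → ℕ
val q m = valFuel m q m

-- Jacobi symbol J(a,m) = ∏_{p prime, p ∣ m} (a/p)^{v_p(m)},
-- the product being taken over all primes p = q + 2 ≤ m (primes not dividing m contribute 1).
jacobiUpTo : ℕ → ℕ → ℕ → ℤ
jacobiUpTo a m zero    = + 1
jacobiUpTo a m (suc q) =
  (if does (prime? (suc (suc q))) then legendre a q ^ val q m else + 1) * jacobiUpTo a m q

J : ℕ → ℕ → ℤ
J a m = jacobiUpTo a m (m ∸ 1)

sumTo : ℕ → (ℕ → ℤ) → ℤ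
sumTo zero    f = f 0
sumTo (suc k) f = sumTo k f + f (suc k)

aCoeff : ℕ → ℕ → ℤ → ℤ
aCoeff n k x = sumTo k (λ m → J (k ∸ m) n * x ^ m)

sumFin : (n : ℕ) → (Fin n → ℤ) → ℤ
sumFin zero    f = + 0
sumFin (suc n) f = f zero + sumFin n (λ i → f (suc i))

det : (n : ℕ) → (Fin n → Fin n → ℤ) → ℤ
det zero    M = + 1
det (suc n) M = sumFin (suc n) (λ j →
  ((- (+ 1)) ^ toℕ j) * (M zero j * det n (λ r c → M (suc r) (punchIn j c))))

-- H_n(x) = det [ a_{i+j-1}(x) ]_{1≤i,j≤n}; with 0-based indices i',j' the entry is a_{i'+j'+1}(x).
H : ℕ → ℤ → ℤ
H n x = det n (λ i j → aCoeff n (suc (toℕ i ℕ.+ toℕ j)) x)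

module Submission where

open import Defs
open import Data.Nat using (ℕ; zero; suc; nonTrivial⇒≢1)
open import Data.Nat.Divisibility using (_∣_; divides; ∣-trans)
open import Data.Nat.Primality using (Composite; composite⇒nonTrivial)
open import Data.Integer using (ℤ; +_)
open import Data.Product using (_,_)
open import Data.Empty using (⊥-elim)
open import Relation.Nullary using (¬_)
open import Relation.Binary.PropositionalEquality using (_≡_; refl)

-- Horner's rule gives a_{k+1} = x a_k + J(k + 1, n).  Hence, if a sequence w
-- with w 0 = 1, w 1 = 0 and w (N+1) = 0 annihilates every window of J(·, n),
-- i.e. Σ_{t ≤ N} w t J(s + t, n) = 0 for all s, then by summation by parts the
-- rows R_i of H_n satisfy Σ_i (u_i - x u_{i+1}) R_i = 0 with u = (0, w 0, w 1, …),
-- a vanishing combination in which R_1 has coefficient 1, so H_n(x) = 0.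
-- Such a w comes from an odd prime p ∣ n:
--   * if p² ∣ n, J(·, n) has period m = n / p, and w = δ₀ - δ_m works;
--   * if p ∥ n and r = n / p > 1, then J(s + k r, n) is the Legendre symbol of
--     s + k r modulo p times a factor independent of k, and the Legendre symbol
--     sums to 0 over p consecutive terms of a progression whose difference is
--     prime to p, so the indicator of the multiples of r works.

module Counting where

  open import Data.Nat as ℕ
  open import Data.Nat.Properties
  open import Data.Fin as Fin using (Fin; zero; suc; toℕ)
  import Data.Fin.Properties as FinP
  open import Relation.Nullary using (yes; no)
  open import Relation.Binary.PropositionalEquality
  open import Data.Empty using (⊥-elim)
  import Algebra.Properties.Semiring.Sum +-*-semiring as ℕΣ

  δ : ℕ → ℕ → ℕ
  δ a b with a ≟ b
  ... | yes _ = 1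
  ... | no _  = 0

  δ-refl : ∀ a → δ a a ≡ 1
  δ-refl a with a ≟ a
  ... | yes _   = refl
  ... | no a≢a = ⊥-elim (a≢a refl)

  δ-≢ : ∀ {a b} → a ≢ b → δ a b ≡ 0
  δ-≢ {a} {b} a≢b with a ≟ b
  ... | yes a≡b = ⊥-elim (a≢b a≡b)
  ... | no _    = refl

  δ-suc : ∀ a b → δ (suc a) (suc b) ≡ δ a b
  δ-suc a b with a ≟ b
  ... | yes refl = δ-refl (suc a)
  ... | no a≢b  = δ-≢ (λ e → a≢b (suc-injective e))

  count-point : ∀ N a → a < N → ℕΣ.sum (λ (i : Fin N) → δ (toℕ i) a) ≡ 1
  count-point (suc N) zero    _ = cong suc (ℕΣ.sum-replicate-zero N)
  count-point (suc N) (suc a) (s≤s a<N) =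
    trans (ℕΣ.sum-cong-≗ (λ (i : Fin N) → δ-suc (toℕ i) a)) (count-point N a a<N)

  sum-≤1 : ∀ {N} (f : Fin N → ℕ) → (∀ i → f i ≤ 1) → ℕΣ.sum f ≤ N
  sum-≤1 {zero}  f f≤1 = z≤n
  sum-≤1 {suc N} f f≤1 = +-mono-≤ (f≤1 zero) (sum-≤1 (λ i → f (suc i)) (λ i → f≤1 (suc i)))

  -- If N terms each at most 1 add up to N, every term is 1: removing one term
  -- leaves a sum of at most N - 1.
  sum≡N⇒all-1 : ∀ {N} (f : Fin N → ℕ) → (∀ i → f i ≤ 1) → ℕΣ.sum f ≡ N → ∀ i → f i ≡ 1
  sum≡N⇒all-1 {suc N} f f≤1 ∑f≡N i = ≤-antisym (f≤1 i) (+-cancelʳ-≤ N 1 (f i) (begin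
    suc N                                     ≡⟨ ∑f≡N ⟨
    ℕΣ.sum f                                  ≡⟨ ℕΣ.sum-remove {i = i} f ⟩
    f i + ℕΣ.sum (λ k → f (Fin.punchIn i k))  ≤⟨ +-monoʳ-≤ (f i) (sum-≤1 _ (λ k → f≤1 (Fin.punchIn i k))) ⟩
    f i + N                                   ∎))
    where open ≤-Reasoning

  ones : ∀ N → ℕΣ.sum (λ (_ : Fin N) → 1) ≡ N
  ones zero    = refl
  ones (suc N) = cong suc (ones N)

  at-most-one : ∀ {N} (g : Fin N → ℕ) → (∀ k k′ → g k ≡ g k′ → k ≡ k′) →
    ∀ b → ℕΣ.sum (λ k → δ b (g k)) ≤ 1
  at-most-one {zero}  g injective b = z≤n
  at-most-one {suc N} g injective b with b ≟ g zero
  ... | yes refl = ≤-reflexive (cong suc (trans (ℕΣ.sum-cong-≗ others≡0) (ℕΣ.sum-replicate-zero N)))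
    where
    others≡0 : ∀ k → δ (g zero) (g (suc k)) ≡ 0
    others≡0 k = δ-≢ (λ g₀≡gₖ → FinP.0≢1+n (injective zero (suc k) g₀≡gₖ))
  ... | no b≢g₀ =
    at-most-one (λ k → g (suc k)) (λ k k′ gₖ≡gₖ′ → FinP.suc-injective (injective (suc k) (suc k′) gₖ≡gₖ′)) b

  -- An injective map of Fin N into {0, …, N-1} takes every value exactly once:
  -- the N value counts are at most 1 and add up to N.
  preimage-unique : ∀ N (g : Fin N → ℕ) → (∀ k → g k < N) → (∀ k k′ → g k ≡ g k′ → k ≡ k′) →
    ∀ b → b < N → ℕΣ.sum (λ k → δ b (g k)) ≡ 1
  preimage-unique N g g<N injective b b<N =
    subst (λ c → ℕΣ.sum (λ k → δ c (g k)) ≡ 1) (FinP.toℕ-fromℕ< b<N)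
          (sum≡N⇒all-1 preimages (λ c → at-most-one g injective (toℕ c)) total (Fin.fromℕ< b<N))
    where
    preimages : Fin N → ℕ
    preimages c = ℕΣ.sum (λ k → δ (toℕ c) (g k))
    total : ℕΣ.sum preimages ≡ N
    total = begin
      ℕΣ.sum preimages                                         ≡⟨ ℕΣ.∑-comm {N} {N} (λ c k → δ (toℕ c) (g k)) ⟩
      ℕΣ.sum (λ k → ℕΣ.sum (λ (c : Fin N) → δ (toℕ c) (g k)))  ≡⟨ ℕΣ.sum-cong-≗ (λ k → count-point N (g k) (g<N k)) ⟩
      ℕΣ.sum (λ (_ : Fin N) → 1)                               ≡⟨ ones N ⟩
      N                                                        ∎
      where open ≡-Reasoning


module IntegerSums where

  open Counting using (δ; δ-suc; ones)
  open import Data.Nat as ℕ using (ℕ; zero; suc; _<_; s≤s)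
  import Data.Nat.Properties as ℕP
  open import Data.Integer as ℤ using (ℤ; -_; _*_; _+_; 0ℤ; 1ℤ)
  import Data.Integer.Properties as ℤP
  open import Data.Fin as Fin using (Fin; zero; suc; toℕ)
  import Data.Fin.Properties as FinP
  open import Relation.Binary.PropositionalEquality hiding (J)
  open import Algebra.Properties.Semiring.Sum ℤP.+-*-semiring
    using (sum; sum-cong-≗; sum-syntax; sum-init-last)
  import Algebra.Properties.Semiring.Sum ℕP.+-*-semiring as ℕΣ

  -- Finite sums of integers are the library's sums over Fin; a sum over
  -- {0, …, N-1} is written ∑[ t < N ] f (toℕ t).  The sum of Defs is the
  -- library's sum.
  sumFin≡sum : ∀ n (f : Fin n → ℤ) → sumFin n f ≡ sum f
  sumFin≡sum zero    f = refl
  sumFin≡sum (suc n) f = cong (λ s → f zero + s) (sumFin≡sum n (λ i → f (suc i)))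

  sum-neg : ∀ {n} (f : Fin n → ℤ) → sum (λ i → - f i) ≡ - sum f
  sum-neg {zero}  f = refl
  sum-neg {suc n} f = trans (cong (λ s → - f zero + s) (sum-neg (λ i → f (suc i))))
                            (sym (ℤP.neg-distrib-+ (f zero) _))

  sum-zero : ∀ {n} (f : Fin n → ℤ) → (∀ i → f i ≡ 0ℤ) → sum f ≡ 0ℤ
  sum-zero {zero}  f f≡0 = refl
  sum-zero {suc n} f f≡0 = cong₂ _+_ (f≡0 zero) (sum-zero (λ i → f (suc i)) (λ i → f≡0 (suc i)))

  sum-pos : ∀ {N} (f : Fin N → ℕ) → ℤ.+ (ℕΣ.sum f) ≡ ∑[ i < N ] (ℤ.+ f i)
  sum-pos {zero}  f = refl
  sum-pos {suc N} f = trans (ℤP.pos-+ (f zero) _) (cong (λ z → ℤ.+ f zero + z) (sum-pos (λ i → f (suc i))))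

  sum-ones : ∀ N → ∑[ _ < N ] 1ℤ ≡ ℤ.+ N
  sum-ones N = trans (sym (sum-pos (λ (_ : Fin N) → 1))) (cong ℤ.+_ (ones N))

  sum-pick : ∀ N a (g : ℕ → ℤ) → a < N → ∑[ t < N ] (ℤ.+ δ (toℕ t) a * g (toℕ t)) ≡ g a
  sum-pick (suc N) zero    g _ = begin
    1ℤ * g 0 + ∑[ t < N ] (0ℤ * g (suc (toℕ t)))   ≡⟨ cong₂ _+_ (ℤP.*-identityˡ (g 0)) (sum-zero {N} _ (λ t → refl)) ⟩
    g 0 + 0ℤ                                         ≡⟨ ℤP.+-identityʳ (g 0) ⟩
    g 0                                              ∎
    where open ≡-Reasoning
  sum-pick (suc N) (suc a) g (s≤s a<N) = begin
    0ℤ + ∑[ t < N ] (ℤ.+ δ (suc (toℕ t)) (suc a) * g (suc (toℕ t)))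
      ≡⟨ ℤP.+-identityˡ _ ⟩
    ∑[ t < N ] (ℤ.+ δ (suc (toℕ t)) (suc a) * g (suc (toℕ t)))
      ≡⟨ sum-cong-≗ {N} (λ t → cong (λ d → ℤ.+ d * g (suc (toℕ t))) (δ-suc (toℕ t) a)) ⟩
    ∑[ t < N ] (ℤ.+ δ (toℕ t) a * g (suc (toℕ t)))
      ≡⟨ sum-pick N a (λ t → g (suc t)) a<N ⟩
    g (suc a)  ∎
    where open ≡-Reasoning

  sum-split : ∀ a b (f : ℕ → ℤ) → ∑[ t < a ℕ.+ b ] f (toℕ t) ≡ ∑[ t < a ] f (toℕ t) + ∑[ t < b ] f (a ℕ.+ toℕ t)
  sum-split zero    b f = sym (ℤP.+-identityˡ _)
  sum-split (suc a) b f = trans (cong (λ z → f 0 + z) (sum-split a b (λ t → f (suc t)))) (sym (ℤP.+-assoc (f 0) _ _))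

  sum-blocks : ∀ k r (f : ℕ → ℤ) → ∑[ t < k ℕ.* r ] f (toℕ t) ≡ ∑[ i < k ] ∑[ a < r ] f (toℕ i ℕ.* r ℕ.+ toℕ a)
  sum-blocks zero    r f = refl
  sum-blocks (suc k) r f = begin
    ∑[ t < r ℕ.+ k ℕ.* r ] f (toℕ t)
      ≡⟨ sum-split r (k ℕ.* r) f ⟩
    ∑[ a < r ] f (toℕ a) + ∑[ t < k ℕ.* r ] f (r ℕ.+ toℕ t)
      ≡⟨ cong (λ z → ∑[ a < r ] f (toℕ a) + z) (sum-blocks k r (λ t → f (r ℕ.+ t))) ⟩
    ∑[ a < r ] f (toℕ a) + ∑[ i < k ] ∑[ a < r ] f (r ℕ.+ (toℕ i ℕ.* r ℕ.+ toℕ a))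
      ≡⟨ cong (λ z → ∑[ a < r ] f (toℕ a) + z) (sum-cong-≗ {k} (λ i → sum-cong-≗ {r} (λ a →
           cong f (sym (ℕP.+-assoc r (toℕ i ℕ.* r) (toℕ a)))))) ⟩
    ∑[ a < r ] f (toℕ a) + ∑[ i < k ] ∑[ a < r ] f (r ℕ.+ toℕ i ℕ.* r ℕ.+ toℕ a)  ∎
    where open ≡-Reasoning

  sum-last : ∀ N (f : ℕ → ℤ) → ∑[ t < suc N ] f (toℕ t) ≡ ∑[ t < N ] f (toℕ t) + f N
  sum-last N f = trans (sum-init-last {N} (λ t → f (toℕ t)))
    (cong₂ _+_ (sum-cong-≗ {N} (λ t → cong f (FinP.toℕ-inject₁ t))) (cong f (FinP.toℕ-fromℕ N)))


module Determinants where

  open import Data.Nat as ℕ using (ℕ; zero; suc)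
  open import Data.Integer as ℤ using (ℤ; -_; _*_; _+_; _^_; 0ℤ; 1ℤ; -1ℤ)
  import Data.Integer.Properties as ℤP
  open import Data.Integer.Tactic.RingSolver using (solve-∀)
  open import Data.Fin as Fin using (Fin; zero; suc; toℕ; punchIn; punchOut)
  import Data.Fin.Properties as FinP
  open import Data.Sum using (inj₁; inj₂)
  open import Data.Empty using (⊥-elim)
  open import Relation.Nullary using (yes; no)
  open import Relation.Binary.PropositionalEquality
  open import Function using (_∘_)
  open IntegerSums
  open import Algebra.Properties.Semiring.Sum ℤP.+-*-semiring
    using (sum; sum-cong-≗; sum-remove; ∑-comm; ∑-distrib-+; *-distribˡ-sum; *-distribʳ-sum)
  open import Algebra.Properties.AbelianGroup ℤP.+-0-abelianGroup using (inverseˡ-unique; xyx⁻¹≈y)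

  sum-offDiagonal : ∀ {n} (F : Fin (suc n) → Fin (suc n) → ℤ) →
    sum (λ j → sum (λ k → F j (punchIn j k))) ≡ sum (λ j → sum (F j)) + - sum (λ j → F j j)
  sum-offDiagonal F = begin
    sum (λ j → sum (λ k → F j (punchIn j k)))    ≡⟨ sum-cong-≗ (λ j → off j) ⟩
    sum (λ j → sum (F j) + - F j j)              ≡⟨ ∑-distrib-+ (λ j → sum (F j)) (λ j → - F j j) ⟩
    sum (λ j → sum (F j)) + sum (λ j → - F j j)  ≡⟨ cong (λ s → sum (λ j → sum (F j)) + s) (sum-neg (λ j → F j j)) ⟩
    sum (λ j → sum (F j)) + - sum (λ j → F j j)  ∎
    where
    open ≡-Reasoning
    move : ∀ a s t → s ≡ a + t → t ≡ s + - a
    move a s t refl = sym (xyx⁻¹≈y a t)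
    off : ∀ j → sum (λ k → F j (punchIn j k)) ≡ sum (F j) + - F j j
    off j = move (F j j) (sum (F j)) _ (sum-remove {i = j} (F j))

  sum-offDiagonal-sym : ∀ {n} (F : Fin (suc n) → Fin (suc n) → ℤ) →
    sum (λ j → sum (λ k → F j (punchIn j k))) ≡ sum (λ j → sum (λ k → F (punchIn j k) j))
  sum-offDiagonal-sym F = begin
    sum (λ j → sum (λ k → F j (punchIn j k)))                  ≡⟨ sum-offDiagonal F ⟩
    sum (λ j → sum (F j)) + - sum (λ j → F j j)                ≡⟨ cong (_+ - sum (λ j → F j j)) (∑-comm F) ⟩
    sum (λ j → sum (λ i → F i j)) + - sum (λ j → F j j)        ≡⟨ sum-offDiagonal (λ j i → F i j) ⟨
    sum (λ j → sum (λ k → F (punchIn j k) j))                  ∎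
    where open ≡-Reasoning

  sgn : ∀ {n} → Fin n → ℤ
  sgn j = -1ℤ ^ toℕ j

  minor : ∀ {n} → (Fin (suc n) → Fin (suc n) → ℤ) → Fin (suc n) → Fin n → Fin n → ℤ
  minor M j r c = M (suc r) (punchIn j c)

  det-laplace : ∀ n (M : Fin (suc n) → Fin (suc n) → ℤ) →
    det (suc n) M ≡ sum (λ j → sgn j * (M zero j * det n (minor M j)))
  det-laplace n M = sumFin≡sum (suc n) (λ j → sgn j * (M zero j * det n (minor M j)))

  det-cong : ∀ n {M N : Fin n → Fin n → ℤ} → (∀ i j → M i j ≡ N i j) → det n M ≡ det n N
  det-cong zero    M≡N = refl
  det-cong (suc n) {M} {N} M≡N = begin
    det (suc n) M                                       ≡⟨ det-laplace n M ⟩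
    sum (λ j → sgn j * (M zero j * det n (minor M j)))  ≡⟨ sum-cong-≗ entry ⟩
    sum (λ j → sgn j * (N zero j * det n (minor N j)))  ≡⟨ det-laplace n N ⟨
    det (suc n) N                                       ∎
    where
    open ≡-Reasoning
    entry : ∀ j → sgn j * (M zero j * det n (minor M j)) ≡ sgn j * (N zero j * det n (minor N j))
    entry j = cong₂ (λ m d → sgn j * (m * d)) (M≡N zero j)
                    (det-cong n (λ r c → M≡N (suc r) (punchIn j c)))

  -- The columns other than a and b (given as b ≠ a), in increasing order.
  otherColumns : ∀ {n} (a b : Fin (suc (suc n))) → a ≢ b → Fin n → Fin (suc (suc n))
  otherColumns a b a≢b c = punchIn a (punchIn (punchOut a≢b) c)

  otherColumns-sym : ∀ {n} (a b : Fin (suc (suc n))) (a≢b : a ≢ b) (b≢a : b ≢ a) →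
    ∀ c → otherColumns a b a≢b c ≡ otherColumns b a b≢a c
  otherColumns-sym zero    zero    a≢b _ c = ⊥-elim (a≢b refl)
  otherColumns-sym zero    (suc b) _   _ c = refl
  otherColumns-sym (suc a) zero    _   _ c = refl
  otherColumns-sym {suc n} (suc a) (suc b) _ _ zero = refl
  otherColumns-sym {suc n} (suc a) (suc b) a≢b b≢a (suc c) =
    cong suc (otherColumns-sym a b (a≢b ∘ cong suc) (b≢a ∘ cong suc) c)

  pairSign : ∀ {n} (a b : Fin (suc (suc n))) → a ≢ b → ℤ
  pairSign a b a≢b = sgn a * sgn (punchOut a≢b)

  pairSign-antisym : ∀ {n} (a b : Fin (suc (suc n))) (a≢b : a ≢ b) (b≢a : b ≢ a) →
    pairSign a b a≢b ≡ - pairSign b a b≢a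
  pairSign-antisym zero zero a≢b _ = ⊥-elim (a≢b refl)
  pairSign-antisym zero (suc b) _ _ = flip (sgn b)
    where
    flip : ∀ s → 1ℤ * s ≡ - ((-1ℤ * s) * 1ℤ)
    flip = solve-∀
  pairSign-antisym (suc a) zero _ _ = flip (sgn a)
    where
    flip : ∀ s → (-1ℤ * s) * 1ℤ ≡ - (1ℤ * s)
    flip = solve-∀
  pairSign-antisym {zero} (suc zero) (suc zero) a≢b _ = ⊥-elim (a≢b refl)
  pairSign-antisym {suc n} (suc a) (suc b) a≢b b≢a = begin
    (-1ℤ * sgn a) * (-1ℤ * sgn (punchOut a≢b′))  ≡⟨ both-shift (sgn a) _ ⟩
    pairSign a b a≢b′                            ≡⟨ pairSign-antisym a b a≢b′ b≢a′ ⟩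
    - pairSign b a b≢a′                          ≡⟨ cong -_ (both-shift (sgn b) _) ⟨
    - ((-1ℤ * sgn b) * (-1ℤ * sgn (punchOut b≢a′)))  ∎
    where
    open ≡-Reasoning
    a≢b′ = λ e → a≢b (cong suc e)
    b≢a′ = λ e → b≢a (cong suc e)
    both-shift : ∀ x y → (-1ℤ * x) * (-1ℤ * y) ≡ x * y
    both-shift = solve-∀

  -- The term of the expansion of det M along its first two rows which takes
  -- column a from row 0 and column b from row 1 (zero when a = b).
  pairTerm : ∀ n (M : Fin (suc (suc n)) → Fin (suc (suc n)) → ℤ) (a b : Fin (suc (suc n))) → ℤ
  pairTerm n M a b with a Fin.≟ b
  ... | yes _   = 0ℤ
  ... | no a≢b = pairSign a b a≢b * (M zero a * (M (suc zero) b *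
                   det n (λ r c → M (suc (suc r)) (otherColumns a b a≢b c))))

  pairTerm-punchIn : ∀ n M (j : Fin (suc (suc n))) (k : Fin (suc n)) →
    pairTerm n M j (punchIn j k) ≡
      sgn j * sgn k * (M zero j * (M (suc zero) (punchIn j k) * det n (minor (minor M j) k)))
  pairTerm-punchIn n M j k with j Fin.≟ punchIn j k
  ... | yes j≡b = ⊥-elim (FinP.punchInᵢ≢i j k (sym j≡b))
  ... | no j≢b rewrite trans (FinP.punchOut-cong j {i≢j = j≢b} {i≢k = FinP.punchInᵢ≢i j k ∘ sym} refl)
                             (FinP.punchOut-punchIn j {k}) = refl

  det-pairs : ∀ n M → det (suc (suc n)) M ≡ sum (λ j → sum (λ k → pairTerm n M j (punchIn j k)))
  det-pairs n M = trans (det-laplace (suc n) M) (sum-cong-≗ column)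
    where
    open ≡-Reasoning
    column : ∀ j → sgn j * (M zero j * det (suc n) (minor M j)) ≡
                   sum (λ k → pairTerm n M j (punchIn j k))
    column j = begin
      sgn j * (M zero j * det (suc n) (minor M j))
        ≡⟨ cong (λ d → sgn j * (M zero j * d)) (det-laplace n (minor M j)) ⟩
      sgn j * (M zero j * sum T)
        ≡⟨ cong (sgn j *_) (*-distribˡ-sum (M zero j) T) ⟩
      sgn j * sum (λ k → M zero j * T k)
        ≡⟨ *-distribˡ-sum (sgn j) (λ k → M zero j * T k) ⟩
      sum (λ k → sgn j * (M zero j * T k))
        ≡⟨ sum-cong-≗ (λ k → trans (rearrange k) (sym (pairTerm-punchIn n M j k))) ⟩
      sum (λ k → pairTerm n M j (punchIn j k))  ∎
      where
      T : Fin (suc n) → ℤ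
      T k = sgn k * (M (suc zero) (punchIn j k) * det n (minor (minor M j) k))
      rearrange : ∀ k → sgn j * (M zero j * T k) ≡
        sgn j * sgn k * (M zero j * (M (suc zero) (punchIn j k) * det n (minor (minor M j) k)))
      rearrange k = swap₄ (sgn j) (M zero j) (sgn k) (M (suc zero) (punchIn j k)) (det n (minor (minor M j) k))
        where
        swap₄ : ∀ s m t x d → s * (m * (t * (x * d))) ≡ s * t * (m * (x * d))
        swap₄ = solve-∀

  swap₀₁ : ∀ {n} → Fin (suc (suc n)) → Fin (suc (suc n))
  swap₀₁ zero          = suc zero
  swap₀₁ (suc zero)    = zero
  swap₀₁ (suc (suc i)) = suc (suc i)

  pairTerm-swap : ∀ n M (a b : Fin (suc (suc n))) →
    pairTerm n (λ i → M (swap₀₁ i)) a b ≡ - pairTerm n M b a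
  pairTerm-swap n M a b with a Fin.≟ b | b Fin.≟ a
  ... | yes _   | yes _   = refl
  ... | yes a≡b | no b≢a = ⊥-elim (b≢a (sym a≡b))
  ... | no a≢b | yes b≡a = ⊥-elim (a≢b (sym b≡a))
  ... | no a≢b | no b≢a = begin
    pairSign a b a≢b * (M (suc zero) a * (M zero b * det n (rest a≢b)))
      ≡⟨ cong₂ (λ s d → s * (M (suc zero) a * (M zero b * d)))
               (pairSign-antisym a b a≢b b≢a)
               (det-cong n (λ r c → cong (M (suc (suc r))) (otherColumns-sym a b a≢b b≢a c))) ⟩
    - pairSign b a b≢a * (M (suc zero) a * (M zero b * det n (rest′ b≢a)))
      ≡⟨ exchange (pairSign b a b≢a) (M (suc zero) a) (M zero b) _ ⟩
    - (pairSign b a b≢a * (M zero b * (M (suc zero) a * det n (rest′ b≢a))))  ∎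
    where
    open ≡-Reasoning
    rest : a ≢ b → Fin n → Fin n → ℤ
    rest a≢b r c = M (suc (suc r)) (otherColumns a b a≢b c)
    rest′ : b ≢ a → Fin n → Fin n → ℤ
    rest′ b≢a r c = M (suc (suc r)) (otherColumns b a b≢a c)
    exchange : ∀ s p q d → - s * (p * (q * d)) ≡ - (s * (q * (p * d)))
    exchange = solve-∀

  det-swap₀ : ∀ n M → det (suc (suc n)) (λ i → M (swap₀₁ i)) ≡ - det (suc (suc n)) M
  det-swap₀ n M = begin
    det (suc (suc n)) (λ i → M (swap₀₁ i))
      ≡⟨ det-pairs n (λ i → M (swap₀₁ i)) ⟩
    sum (λ j → sum (λ k → pairTerm n (λ i → M (swap₀₁ i)) j (punchIn j k)))
      ≡⟨ sum-cong-≗ (λ j → sum-cong-≗ (λ k → pairTerm-swap n M j (punchIn j k))) ⟩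
    sum (λ j → sum (λ k → - pairTerm n M (punchIn j k) j))
      ≡⟨ sum-cong-≗ (λ j → sum-neg (λ k → pairTerm n M (punchIn j k) j)) ⟩
    sum (λ j → - sum (λ k → pairTerm n M (punchIn j k) j))
      ≡⟨ sum-neg (λ j → sum (λ k → pairTerm n M (punchIn j k) j)) ⟩
    - sum (λ j → sum (λ k → pairTerm n M (punchIn j k) j))
      ≡⟨ cong -_ (sum-offDiagonal-sym (pairTerm n M)) ⟨
    - sum (λ j → sum (λ k → pairTerm n M j (punchIn j k)))
      ≡⟨ cong -_ (det-pairs n M) ⟨
    - det (suc (suc n)) M  ∎
    where open ≡-Reasoning

  self-negative⇒0 : ∀ d → d ≡ - d → d ≡ 0ℤ
  self-negative⇒0 (ℤ.+ zero)  _  = refl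
  self-negative⇒0 ℤ.+[1+ _ ] ()
  self-negative⇒0 ℤ.-[1+ _ ] ()

  -- A matrix whose row 0 equals another row has determinant 0.  Exchanging
  -- rows 0 and 1 brings the repeated row into every minor of row 0.
  det-equalRows : ∀ n (i : Fin (suc n)) M → (∀ c → M zero c ≡ M (suc i) c) →
    det (suc (suc n)) M ≡ 0ℤ
  det-equalRows n zero M row₀≡row₁ =
    self-negative⇒0 _ (trans (det-cong (suc (suc n)) same) (det-swap₀ n M))
    where
    same : ∀ i c → M i c ≡ M (swap₀₁ i) c
    same zero          c = row₀≡row₁ c
    same (suc zero)    c = sym (row₀≡row₁ c)
    same (suc (suc i)) c = refl
  det-equalRows (suc n) (suc i) M row₀≡row = begin
    det (suc (suc (suc n))) M                   ≡⟨ ℤP.neg-involutive _ ⟨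
    - - det (suc (suc (suc n))) M               ≡⟨ cong -_ (det-swap₀ (suc n) M) ⟨
    - det (suc (suc (suc n))) M′                ≡⟨ cong -_ (det-laplace (suc (suc n)) M′) ⟩
    - sum (λ j → sgn j * (M′ zero j * det (suc (suc n)) (minor M′ j)))
      ≡⟨ cong -_ (sum-zero _ term-zero) ⟩
    0ℤ                                          ∎
    where
    open ≡-Reasoning
    M′ : Fin (suc (suc (suc n))) → Fin (suc (suc (suc n))) → ℤ
    M′ r = M (swap₀₁ r)
    minor-singular : ∀ j → det (suc (suc n)) (minor M′ j) ≡ 0ℤ
    minor-singular j = det-equalRows n i (minor M′ j) (λ c → row₀≡row (punchIn j c))
    term-zero : ∀ j → sgn j * (M′ zero j * det (suc (suc n)) (minor M′ j)) ≡ 0ℤ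
    term-zero j rewrite minor-singular j | ℤP.*-zeroʳ (M′ zero j) = ℤP.*-zeroʳ (sgn j)

  withFirstRow : ∀ {n} → (Fin (suc n) → ℤ) → (Fin (suc n) → Fin (suc n) → ℤ) → Fin (suc n) → Fin (suc n) → ℤ
  withFirstRow row M zero    = row
  withFirstRow row M (suc r) = M (suc r)

  alien-cofactors : ∀ n (i : Fin n) (M : Fin (suc n) → Fin (suc n) → ℤ) →
    sum (λ j → sgn j * (M (suc i) j * det n (minor M j))) ≡ 0ℤ
  alien-cofactors (suc n) i M = begin
    sum (λ j → sgn j * (M (suc i) j * det (suc n) (minor M j)))
      ≡⟨ det-laplace (suc n) (withFirstRow (M (suc i)) M) ⟨
    det (suc (suc n)) (withFirstRow (M (suc i)) M)
      ≡⟨ det-equalRows n i (withFirstRow (M (suc i)) M) (λ c → refl) ⟩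
    0ℤ  ∎
    where open ≡-Reasoning

  -- If a linear combination Σᵢ vᵢ · (row i) of the rows of M vanishes, then
  -- v₀ · det M = 0: expanding along row 0, v₀ · (row 0) is minus the
  -- combination of the later rows, whose expansions against the cofactors of
  -- row 0 vanish.
  scaled-det : ∀ n (M : Fin (suc n) → Fin (suc n) → ℤ) (v : Fin (suc n) → ℤ) →
    (∀ j → sum (λ i → v i * M i j) ≡ 0ℤ) → v zero * det (suc n) M ≡ 0ℤ
  scaled-det n M v combination = begin
    v zero * det (suc n) M
      ≡⟨ cong (v zero *_) (det-laplace n M) ⟩
    v zero * sum (λ j → sgn j * (M zero j * m j))
      ≡⟨ *-distribˡ-sum (v zero) (λ j → sgn j * (M zero j * m j)) ⟩
    sum (λ j → v zero * (sgn j * (M zero j * m j)))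
      ≡⟨ sum-cong-≗ first-row ⟩
    sum (λ j → - sum (λ i → later i j))
      ≡⟨ sum-neg (λ j → sum (λ i → later i j)) ⟩
    - sum (λ j → sum (λ i → later i j))
      ≡⟨ cong -_ (∑-comm (λ j i → later i j)) ⟩
    - sum (λ i → sum (λ j → later i j))
      ≡⟨ cong -_ (sum-zero _ later-row) ⟩
    0ℤ  ∎
    where
    open ≡-Reasoning
    m : Fin (suc n) → ℤ
    m j = det n (minor M j)
    later : Fin n → Fin (suc n) → ℤ
    later i j = v (suc i) * (sgn j * (M (suc i) j * m j))
    rest : Fin (suc n) → ℤ
    rest j = sum (λ i → v (suc i) * M (suc i) j)
    first-entry : ∀ j → v zero * M zero j ≡ - rest j
    first-entry j = inverseˡ-unique (v zero * M zero j) (rest j) (combination j)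
    first-row : ∀ j → v zero * (sgn j * (M zero j * m j)) ≡ - sum (λ i → later i j)
    first-row j = begin
      v zero * (sgn j * (M zero j * m j))         ≡⟨ regroup (v zero) (sgn j) (M zero j) (m j) ⟩
      v zero * M zero j * (sgn j * m j)           ≡⟨ cong (_* (sgn j * m j)) (first-entry j) ⟩
      - rest j * (sgn j * m j)                    ≡⟨ ℤP.neg-distribˡ-* (rest j) (sgn j * m j) ⟨
      - (rest j * (sgn j * m j))                  ≡⟨ cong -_ (*-distribʳ-sum (sgn j * m j) (λ i → v (suc i) * M (suc i) j)) ⟩
      - sum (λ i → v (suc i) * M (suc i) j * (sgn j * m j))
        ≡⟨ cong -_ (sum-cong-≗ (λ i → regroup′ (v (suc i)) (M (suc i) j) (sgn j) (m j))) ⟩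
      - sum (λ i → later i j)                     ∎
      where
      regroup : ∀ v s a d → v * (s * (a * d)) ≡ v * a * (s * d)
      regroup = solve-∀
      regroup′ : ∀ v a s d → v * a * (s * d) ≡ v * (s * (a * d))
      regroup′ = solve-∀
    later-row : ∀ i → sum (λ j → later i j) ≡ 0ℤ
    later-row i = begin
      sum (λ j → later i j)
        ≡⟨ *-distribˡ-sum (v (suc i)) (λ j → sgn j * (M (suc i) j * m j)) ⟨
      v (suc i) * sum (λ j → sgn j * (M (suc i) j * m j))
        ≡⟨ cong (v (suc i) *_) (alien-cofactors n i M) ⟩
      v (suc i) * 0ℤ
        ≡⟨ ℤP.*-zeroʳ (v (suc i)) ⟩
      0ℤ  ∎

  -- If some linear combination of the rows of M with a nonzero coefficient
  -- vanishes, then det M = 0: either the coefficient of row 0 is nonzero and we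
  -- cancel it in scaled-det, or it is zero and the combination of the later
  -- rows kills every minor of row 0.
  det-dependentRows : ∀ n (M : Fin n → Fin n → ℤ) (v : Fin n → ℤ) (k : Fin n) → v k ≢ 0ℤ →
    (∀ j → sum (λ i → v i * M i j) ≡ 0ℤ) → det n M ≡ 0ℤ
  det-dependentRows (suc n) M v k vₖ≢0 combination with ℤP.i*j≡0⇒i≡0∨j≡0 (v zero) (scaled-det n M v combination)
  ... | inj₂ det≡0 = det≡0
  det-dependentRows (suc n) M v zero    v₀≢0 combination | inj₁ v₀≡0 = ⊥-elim (v₀≢0 v₀≡0)
  det-dependentRows (suc n) M v (suc k) vₖ≢0 combination | inj₁ v₀≡0 = begin
    det (suc n) M                                         ≡⟨ det-laplace n M ⟩
    sum (λ j → sgn j * (M zero j * det n (minor M j)))    ≡⟨ sum-zero _ term-zero ⟩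
    0ℤ                                                    ∎
    where
    open ≡-Reasoning
    minor-combination : ∀ j c → sum (λ i → v (suc i) * minor M j i c) ≡ 0ℤ
    minor-combination j c = begin
      sum (λ i → v (suc i) * minor M j i c)                          ≡⟨ ℤP.+-identityˡ _ ⟨
      0ℤ * M zero (punchIn j c) + sum (λ i → v (suc i) * minor M j i c)
        ≡⟨ cong (λ a → a * M zero (punchIn j c) + sum (λ i → v (suc i) * minor M j i c)) v₀≡0 ⟨
      sum (λ i → v i * M i (punchIn j c))                            ≡⟨ combination (punchIn j c) ⟩
      0ℤ                                                             ∎
    term-zero : ∀ j → sgn j * (M zero j * det n (minor M j)) ≡ 0ℤ
    term-zero j
      rewrite det-dependentRows n (minor M j) (λ i → v (suc i)) k vₖ≢0 (minor-combination j)
            | ℤP.*-zeroʳ (M zero j) = ℤP.*-zeroʳ (sgn j)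


module HankelReduction where

  open Determinants
  open import Data.Nat as ℕ using (ℕ; zero; suc; _∸_)
  open import Data.Integer as ℤ using (ℤ; -_; _*_; _+_; _^_; 0ℤ; 1ℤ)
  import Data.Integer.Properties as ℤP
  import Data.Nat.Properties as ℕP
  open import Data.Integer.Tactic.RingSolver using (solve-∀)
  open import Data.Fin as Fin using (Fin; zero; suc; toℕ)
  open import Relation.Binary.PropositionalEquality hiding (J)
  open import Algebra.Properties.Semiring.Sum ℤP.+-*-semiring
    using (sum-cong-≗; sum-syntax)

  sumTo-cong : ∀ k {f g : ℕ → ℤ} → (∀ m → f m ≡ g m) → sumTo k f ≡ sumTo k g
  sumTo-cong zero    f≡g = f≡g 0
  sumTo-cong (suc k) f≡g = cong₂ _+_ (sumTo-cong k f≡g) (f≡g (suc k))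

  sumTo-unfoldˡ : ∀ k (f : ℕ → ℤ) → sumTo (suc k) f ≡ f 0 + sumTo k (λ m → f (suc m))
  sumTo-unfoldˡ zero    f = refl
  sumTo-unfoldˡ (suc k) f = trans (cong (_+ f (suc (suc k))) (sumTo-unfoldˡ k f))
                                  (ℤP.+-assoc (f 0) _ _)

  sumTo-*ˡ : ∀ k c (f : ℕ → ℤ) → sumTo k (λ m → c * f m) ≡ c * sumTo k f
  sumTo-*ˡ zero    c f = refl
  sumTo-*ˡ (suc k) c f = trans (cong (_+ c * f (suc k)) (sumTo-*ˡ k c f))
                               (sym (ℤP.*-distribˡ-+ c _ _))

  horner : ∀ (c : ℕ → ℤ) x k →
    sumTo (suc k) (λ m → c (suc k ∸ m) * x ^ m) ≡ x * sumTo k (λ m → c (k ∸ m) * x ^ m) + c (suc k)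
  horner c x k = begin
    sumTo (suc k) (λ m → c (suc k ∸ m) * x ^ m)
      ≡⟨ sumTo-unfoldˡ k (λ m → c (suc k ∸ m) * x ^ m) ⟩
    c (suc k) * 1ℤ + sumTo k (λ m → c (k ∸ m) * (x * x ^ m))
      ≡⟨ cong (λ s → c (suc k) * 1ℤ + s) (sumTo-cong k (λ m → pull-x (c (k ∸ m)) x (x ^ m))) ⟩
    c (suc k) * 1ℤ + sumTo k (λ m → x * (c (k ∸ m) * x ^ m))
      ≡⟨ cong (λ s → c (suc k) * 1ℤ + s) (sumTo-*ˡ k x (λ m → c (k ∸ m) * x ^ m)) ⟩
    c (suc k) * 1ℤ + x * sumTo k (λ m → c (k ∸ m) * x ^ m)
      ≡⟨ swap-+ (c (suc k)) _ ⟩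
    x * sumTo k (λ m → c (k ∸ m) * x ^ m) + c (suc k)  ∎
    where
    open ≡-Reasoning
    pull-x : ∀ a x y → a * (x * y) ≡ x * (a * y)
    pull-x = solve-∀
    swap-+ : ∀ a b → a * 1ℤ + b ≡ b + a
    swap-+ = solve-∀

  telescope : ∀ N (u B C : ℕ → ℤ) x → (∀ t → B (suc t) ≡ x * B t + C t) →
    ∑[ t < suc N ] ((u (toℕ t) + - (x * u (suc (toℕ t)))) * B (toℕ t)) ≡
      u 0 * B 0 + - (x * u (suc N) * B N) + ∑[ t < N ] (u (suc (toℕ t)) * C (toℕ t))
  telescope zero    u B C x step = boundary (u 0) (u 1) (B 0) x
    where
    boundary : ∀ a b c x → (a + - (x * b)) * c + 0ℤ ≡ a * c + - (x * b * c) + 0ℤ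
    boundary = solve-∀
  telescope (suc N) u B C x step = begin
    (u 0 + - (x * u 1)) * B 0 + ∑[ t < suc N ] ((u (suc (toℕ t)) + - (x * u (suc (suc (toℕ t))))) * B (suc (toℕ t)))
      ≡⟨ cong (λ s → (u 0 + - (x * u 1)) * B 0 + s)
              (telescope N (λ t → u (suc t)) (λ t → B (suc t)) (λ t → C (suc t)) x (λ t → step (suc t))) ⟩
    (u 0 + - (x * u 1)) * B 0 + (u 1 * B 1 + - last + rest)
      ≡⟨ cong (λ b → (u 0 + - (x * u 1)) * B 0 + (u 1 * b + - last + rest)) (step 0) ⟩
    (u 0 + - (x * u 1)) * B 0 + (u 1 * (x * B 0 + C 0) + - last + rest)
      ≡⟨ regroup (u 0) (u 1) (B 0) (C 0) x last rest ⟩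
    u 0 * B 0 + - last + (u 1 * C 0 + rest)  ∎
    where
    open ≡-Reasoning
    last = x * u (suc (suc N)) * B (suc N)
    rest = ∑[ t < N ] (u (suc (suc (toℕ t))) * C (suc (toℕ t)))
    regroup : ∀ a b c d x w s → (a + - (x * b)) * c + (b * (x * c + d) + - w + s) ≡ a * c + - w + (b * d + s)
    regroup = solve-∀

  aCoeff-step : ∀ n k x → aCoeff n (suc k) x ≡ x * aCoeff n k x + J (suc k) n
  aCoeff-step n k x = horner (λ a → J a n) x k

  -- The rows
  -- R_i = (a_{i+j+1})_j then satisfy Σ_i (u_i - x u_{i+1}) R_i = 0, where
  -- u = (0, w 0, w 1, …), and the coefficient of R_1 is w 0 - x w 1 = 1.
  H-vanishes-if-annihilated : ∀ N x (w : ℕ → ℤ) → w 0 ≡ 1ℤ → w 1 ≡ 0ℤ → w (suc N) ≡ 0ℤ →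
    (∀ s → ∑[ t < suc N ] (w (toℕ t) * J (s ℕ.+ toℕ t) (suc (suc N))) ≡ 0ℤ) →
    H (suc (suc N)) x ≡ 0ℤ
  H-vanishes-if-annihilated N x w w₀≡1 w₁≡0 wₙ≡0 annihilates =
    det-dependentRows n (λ i j → aCoeff n (suc (toℕ i ℕ.+ toℕ j)) x) (λ i → V (toℕ i))
      (suc zero) V₁≢0 rows-dependent
    where
    n : ℕ
    n = suc (suc N)
    u : ℕ → ℤ
    u zero    = 0ℤ
    u (suc t) = w t
    V : ℕ → ℤ
    V t = u t + - (x * u (suc t))
    V₁≡1 : V 1 ≡ 1ℤ
    V₁≡1 = trans (cong₂ (λ a b → a + - (x * b)) w₀≡1 w₁≡0) (one x)
      where
      one : ∀ x → 1ℤ + - (x * 0ℤ) ≡ 1ℤ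
      one = solve-∀
    V₁≢0 : V 1 ≢ 0ℤ
    V₁≢0 V₁≡0 with trans (sym V₁≡1) V₁≡0
    ... | ()
    rows-dependent : ∀ j → ∑[ i < n ] (V (toℕ i) * aCoeff n (suc (toℕ i ℕ.+ toℕ j)) x) ≡ 0ℤ
    rows-dependent j = begin
      ∑[ t < n ] (V (toℕ t) * B (toℕ t))
        ≡⟨ telescope (suc N) u B C x (λ t → aCoeff-step n (suc (t ℕ.+ toℕ j)) x) ⟩
      0ℤ * B 0 + - (x * w (suc N) * B (suc N)) + ∑[ t < suc N ] (w (toℕ t) * C (toℕ t))
        ≡⟨ cong₂ (λ a b → 0ℤ * B 0 + - (x * a * B (suc N)) + b) wₙ≡0
                 window ⟩
      0ℤ * B 0 + - (x * 0ℤ * B (suc N)) + 0ℤ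
        ≡⟨ vanish (B 0) (B (suc N)) x ⟩
      0ℤ  ∎
      where
      open ≡-Reasoning
      B C : ℕ → ℤ
      B t = aCoeff n (suc (t ℕ.+ toℕ j)) x
      C t = J (suc (suc (t ℕ.+ toℕ j))) n
      window : ∑[ t < suc N ] (w (toℕ t) * C (toℕ t)) ≡ 0ℤ
      window = trans (sum-cong-≗ {suc N} {λ t → w (toℕ t) * C (toℕ t)}
                       (λ t → cong (λ a → w (toℕ t) * J (suc (suc a)) n) (ℕP.+-comm (toℕ t) (toℕ j))))
                     (annihilates (suc (suc (toℕ j))))
      vanish : ∀ a b x → 0ℤ * a + - (x * 0ℤ * b) + 0ℤ ≡ 0ℤ
      vanish = solve-∀


module QuadraticResidues where

  open Counting
  open import Data.Nat as ℕ
  open import Data.Nat.Properties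
  open import Data.Nat.DivMod
  open import Data.Nat.Divisibility
  open import Data.Nat.Primality
  import Data.Integer as ℤ
  open import Data.Nat.Tactic.RingSolver using (solve-∀)
  open import Data.Fin as Fin using (Fin; toℕ)
  import Data.Fin.Properties as FinP
  open import Data.Product using (_,_; proj₁; proj₂)
  open import Data.Sum using (_⊎_; inj₁; inj₂; [_,_]′)
  open import Data.Empty using (⊥-elim)
  open import Relation.Nullary using (yes; no; ¬_)
  open import Relation.Binary.PropositionalEquality
  open import Function using (_∘_)
  open import Data.List using (upTo)
  open import Data.List.Relation.Unary.Any using (any?)
  open import Data.List.Membership.Propositional using (lose; find)
  open import Data.List.Membership.Propositional.Properties using (∈-upTo⁺; ∈-upTo⁻)
  import Algebra.Properties.Semiring.Sum +-*-semiring as ℕΣ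

  ∣∧<⇒≡0 : ∀ {p d} → p ∣ d → d < p → d ≡ 0
  ∣∧<⇒≡0 {d = zero}  _   _   = refl
  ∣∧<⇒≡0 {d = suc d} p∣d d<p = ⊥-elim (<⇒≱ d<p (∣⇒≤ p∣d))

  ∣∧<2p⇒≡0∨≡p : ∀ {p m} → p ∣ m → m < p + p → m ≡ 0 ⊎ m ≡ p
  ∣∧<2p⇒≡0∨≡p         (divides zero          refl) _ = inj₁ refl
  ∣∧<2p⇒≡0∨≡p {p}     (divides (suc zero)    refl) _ = inj₂ (+-identityʳ p)
  ∣∧<2p⇒≡0∨≡p {p}     (divides (suc (suc k)) refl) m<2p =
    ⊥-elim (<⇒≱ m<2p (+-monoʳ-≤ p (m≤m+n p (k * p))))

  %-unchanged⇒∣ : ∀ p .{{_ : NonZero p}} A B → (A + B) % p ≡ A % p → p ∣ B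
  %-unchanged⇒∣ p A B same = ∣m+n∣m⇒∣n {m = (A / p) * p} (divides ((A + B) / p) shifted) (divides (A / p) refl)
    where
    shifted : (A / p) * p + B ≡ ((A + B) / p) * p
    shifted = +-cancelˡ-≡ (A % p) _ _ (begin
      A % p + ((A / p) * p + B)   ≡⟨ +-assoc (A % p) _ B ⟨
      A % p + (A / p) * p + B     ≡⟨ cong (_+ B) (m≡m%n+[m/n]*n A p) ⟨
      A + B                       ≡⟨ m≡m%n+[m/n]*n (A + B) p ⟩
      (A + B) % p + ((A + B) / p) * p   ≡⟨ cong (_+ ((A + B) / p) * p) same ⟩
      A % p + ((A + B) / p) * p   ∎)
      where open ≡-Reasoning

  module OddPrime (q₀ : ℕ) (p-prime : Prime (suc (suc q₀))) (p≢2 : q₀ ≢ 0) where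

    p : ℕ
    p = suc (suc q₀)

    square≡0⇒≡0 : ∀ y → y < p → (y * y) % p ≡ 0 → y ≡ 0
    square≡0⇒≡0 y y<p y²≡0 with euclidsLemma y y p-prime (m%n≡0⇒n∣m (y * y) p y²≡0)
    ... | inj₁ p∣y = ∣∧<⇒≡0 p∣y y<p
    ... | inj₂ p∣y = ∣∧<⇒≡0 p∣y y<p

    -- If y² ≡ z² (mod p) with y ≤ z < p then y = z or y + z = p, since p
    -- divides z² - y² = (z - y)(z + y).
    squares-congruent-≤ : ∀ {y z} → y ≤ z → z < p → (y * y) % p ≡ (z * z) % p → y ≡ z ⊎ y + z ≡ p
    squares-congruent-≤ {y} {z} y≤z z<p same with z ∸ y | m+[n∸m]≡n y≤z
    ... | d | refl
      with euclidsLemma d (y + (y + d)) p-prime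
             (%-unchanged⇒∣ p (y * y) (d * (y + (y + d))) (trans (cong (_% p) (sym (expand y d))) (sym same)))
      where
      expand : ∀ y d → (y + d) * (y + d) ≡ y * y + d * (y + (y + d))
      expand = solve-∀
    ... | inj₁ p∣d = inj₁ (sym (trans (cong (λ e → y + e) (∣∧<⇒≡0 p∣d (≤-<-trans (m≤n+m d y) z<p))) (+-identityʳ y)))
    ... | inj₂ p∣y+z with ∣∧<2p⇒≡0∨≡p p∣y+z (+-mono-< (≤-<-trans (m≤m+n y d) z<p) z<p)
    ...   | inj₂ y+z≡p = inj₂ y+z≡p
    ...   | inj₁ y+z≡0 = inj₁ (trans (m+n≡0⇒m≡0 y y+z≡0) (sym (m+n≡0⇒n≡0 y y+z≡0)))

    squares-congruent : ∀ y z → y < p → z < p → (y * y) % p ≡ (z * z) % p → y ≡ z ⊎ y + z ≡ p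
    squares-congruent y z y<p z<p same with ≤-total y z
    ... | inj₁ y≤z = squares-congruent-≤ y≤z z<p same
    ... | inj₂ z≤y with squares-congruent-≤ z≤y y<p (sym same)
    ...   | inj₁ z≡y   = inj₁ (sym z≡y)
    ...   | inj₂ z+y≡p = inj₂ (trans (+-comm y z) z+y≡p)

    square-complement : ∀ y → y ≤ p → ((p ∸ y) * (p ∸ y)) % p ≡ (y * y) % p
    square-complement y y≤p = begin
      (z * z) % p                  ≡⟨ [m+kn]%n≡m%n (z * z) (2 * y) p ⟨
      (z * z + (2 * y) * p) % p    ≡⟨ cong (_% p) expand ⟩
      (y * y + p * p) % p          ≡⟨ [m+kn]%n≡m%n (y * y) p p ⟩
      (y * y) % p                  ∎
      where
      open ≡-Reasoning
      z = p ∸ y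
      identity : ∀ z y → z * z + (2 * y) * (z + y) ≡ y * y + (z + y) * (z + y)
      identity = solve-∀
      expand : z * z + (2 * y) * p ≡ y * y + p * p
      expand = subst (λ w → z * z + (2 * y) * w ≡ y * y + w * w) (m∸n+n≡m y≤p) (identity z y)

    -- y ≠ p - y because p is odd.
    ≢-complement : ∀ y → y < p → y ≢ p ∸ y
    ≢-complement y y<p y≡p-y with prime⇒irreducible p-prime {2} (divides y (trans (sym y+y≡p) (double y)))
      where
      y+y≡p : y + y ≡ p
      y+y≡p = trans (cong (_+ y) y≡p-y) (m∸n+n≡m (<⇒≤ y<p))
      double : ∀ y → y + y ≡ y * 2
      double = solve-∀
    ... | inj₁ ()
    ... | inj₂ 2≡p = p≢2 (suc-injective (suc-injective (sym 2≡p)))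

    roots : ℕ → ℕ
    roots a = ℕΣ.sum (λ (y : Fin p) → δ ((toℕ y * toℕ y) % p) (a % p))

    is-root-of-square : ∀ y₀ y → 0 < y₀ → y₀ < p → y < p →
      δ ((y * y) % p) ((y₀ * y₀) % p) ≡ δ y y₀ + δ y (p ∸ y₀)
    is-root-of-square y₀ y 0<y₀ y₀<p y<p with y ≟ y₀
    ... | yes refl rewrite δ-refl ((y * y) % p) | δ-≢ (≢-complement y y₀<p) = refl
    ... | no y≢y₀ with y ≟ p ∸ y₀
    ...   | yes refl rewrite square-complement y₀ (<⇒≤ y₀<p) | δ-refl ((y₀ * y₀) % p) = refl
    ...   | no y≢p-y₀ = δ-≢ (λ same → [ y≢y₀ , y≢p-y₀ ∘ complement ]′ (squares-congruent y y₀ y<p y₀<p same))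
      where
      complement : y + y₀ ≡ p → y ≡ p ∸ y₀
      complement y+y₀≡p = trans (sym (m+n∸n≡m y y₀)) (cong (_∸ y₀) y+y₀≡p)

    legendre-count : ∀ a → legendre a q₀ ℤ.+ ℤ.1ℤ ≡ ℤ.+ roots a
    legendre-count a with p ∣? a
    ... | yes p∣a = cong ℤ.+_ (sym (trans (ℕΣ.sum-cong-≗ only-zero) (count-point p 0 (s≤s z≤n))))
      where
      only-zero : ∀ (y : Fin p) → δ ((toℕ y * toℕ y) % p) (a % p) ≡ δ (toℕ y) 0
      only-zero y rewrite n∣m⇒m%n≡0 a p p∣a with toℕ y ≟ 0
      ... | yes y≡0 rewrite y≡0 = δ-refl (0 % p)
      ... | no y≢0 = δ-≢ (y≢0 ∘ square≡0⇒≡0 (toℕ y) (FinP.toℕ<n y))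
    ... | no p∤a with any? (λ y → (y * y) % p ≟ a % p) (upTo p)
    ...   | yes ∃root = cong ℤ.+_ (sym (begin
        roots a                                          ≡⟨ ℕΣ.sum-cong-≗ two-roots ⟩
        ℕΣ.sum (λ (y : Fin p) → δ (toℕ y) y₀ + δ (toℕ y) (p ∸ y₀))
          ≡⟨ ℕΣ.∑-distrib-+ {p} (λ y → δ (toℕ y) y₀) (λ y → δ (toℕ y) (p ∸ y₀)) ⟩
        ℕΣ.sum (λ (y : Fin p) → δ (toℕ y) y₀) + ℕΣ.sum (λ (y : Fin p) → δ (toℕ y) (p ∸ y₀))
          ≡⟨ cong₂ _+_ (count-point p y₀ y₀<p) (count-point p (p ∸ y₀) (∸-monoʳ-< 0<y₀ (<⇒≤ y₀<p))) ⟩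
        2                                                ∎))
      where
      open ≡-Reasoning
      y₀ : ℕ
      y₀ = proj₁ (find ∃root)
      y₀<p : y₀ < p
      y₀<p = ∈-upTo⁻ (proj₁ (proj₂ (find ∃root)))
      y₀²≡a : (y₀ * y₀) % p ≡ a % p
      y₀²≡a = proj₂ (proj₂ (find ∃root))
      0<y₀ : 0 < y₀
      0<y₀ with y₀ | y₀²≡a
      ... | zero  | 0≡a = ⊥-elim (p∤a (m%n≡0⇒n∣m a p (trans (sym 0≡a) (n∣m⇒m%n≡0 0 p (divides 0 refl)))))
      ... | suc _ | _   = s≤s z≤n
      two-roots : ∀ (y : Fin p) → δ ((toℕ y * toℕ y) % p) (a % p) ≡ δ (toℕ y) y₀ + δ (toℕ y) (p ∸ y₀)
      two-roots y = subst (λ b → δ ((toℕ y * toℕ y) % p) b ≡ δ (toℕ y) y₀ + δ (toℕ y) (p ∸ y₀)) y₀²≡a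
                          (is-root-of-square y₀ (toℕ y) 0<y₀ y₀<p (FinP.toℕ<n y))
    ...   | no ∄root = cong ℤ.+_ (sym (trans (ℕΣ.sum-cong-≗ no-root) (ℕΣ.sum-replicate-zero p)))
      where
      no-root : ∀ (y : Fin p) → δ ((toℕ y * toℕ y) % p) (a % p) ≡ 0
      no-root y = δ-≢ (λ is-root → ∄root (lose (∈-upTo⁺ (FinP.toℕ<n y)) is-root))

    progression-injective-≤ : ∀ s r → ¬ p ∣ r → ∀ {k k′} → k ≤ k′ → k′ < p →
      (s + k * r) % p ≡ (s + k′ * r) % p → k ≡ k′
    progression-injective-≤ s r p∤r {k} {k′} k≤k′ k′<p same with k′ ∸ k | m+[n∸m]≡n k≤k′
    ... | d | refl
      with euclidsLemma d r p-prime
             (%-unchanged⇒∣ p (s + k * r) (d * r) (trans (cong (_% p) (sym (expand s k d r))) (sym same)))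
      where
      expand : ∀ s k d r → s + (k + d) * r ≡ s + k * r + d * r
      expand = solve-∀
    ... | inj₁ p∣d = sym (trans (cong (λ e → k + e) (∣∧<⇒≡0 p∣d (≤-<-trans (m≤n+m d k) k′<p))) (+-identityʳ k))
    ... | inj₂ p∣r = ⊥-elim (p∤r p∣r)

    progression-injective : ∀ s r → ¬ p ∣ r → ∀ k k′ → k < p → k′ < p →
      (s + k * r) % p ≡ (s + k′ * r) % p → k ≡ k′
    progression-injective s r p∤r k k′ k<p k′<p same with ≤-total k k′
    ... | inj₁ k≤k′ = progression-injective-≤ s r p∤r k≤k′ k′<p same
    ... | inj₂ k′≤k = sym (progression-injective-≤ s r p∤r k′≤k k<p (sym same))

    -- For p ∤ r there are exactly p pairs (k , y) of residues with y² ≡ s + k r,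
    -- one for each y, since the s + k r run through all residues mod p.
    progression-roots : ∀ s r → ¬ p ∣ r → ℕΣ.sum (λ (k : Fin p) → roots (s + toℕ k * r)) ≡ p
    progression-roots s r p∤r = begin
      ℕΣ.sum (λ (k : Fin p) → roots (s + toℕ k * r))
        ≡⟨ ℕΣ.∑-comm {p} {p} (λ k y → δ ((toℕ y * toℕ y) % p) (residue k)) ⟩
      ℕΣ.sum (λ (y : Fin p) → ℕΣ.sum (λ k → δ ((toℕ y * toℕ y) % p) (residue k)))
        ≡⟨ ℕΣ.sum-cong-≗ {p} (λ y → preimage-unique p residue (λ k → m%n<n (s + toℕ k * r) p) residue-injective
                                       ((toℕ y * toℕ y) % p) (m%n<n (toℕ y * toℕ y) p)) ⟩
      ℕΣ.sum (λ (_ : Fin p) → 1)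
        ≡⟨ ones p ⟩
      p ∎
      where
      open ≡-Reasoning
      residue : Fin p → ℕ
      residue k = (s + toℕ k * r) % p
      residue-injective : ∀ k k′ → residue k ≡ residue k′ → k ≡ k′
      residue-injective k k′ =
        FinP.toℕ-injective ∘ progression-injective s r p∤r (toℕ k) (toℕ k′) (FinP.toℕ<n k) (FinP.toℕ<n k′)


module JacobiSymbol where

  open import Data.Nat as ℕ using (ℕ; zero; suc; _∸_; _<_)
  import Data.Nat.Properties as ℕP
  open import Data.Nat.DivMod using (_%_; _/_; m/n*n≡m; %-remove-+ʳ)
  open import Data.Nat.Divisibility using (_∣_; _∣?_; divides; m%n≡0⇒n∣m; n∣m⇒m%n≡0; ∣n⇒∣m*n; ∣⇒≤)
  open import Data.Nat.Primality using (Prime; prime?; euclidsLemma; prime⇒irreducible)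
  open import Data.Integer as ℤ using (ℤ; _*_; _^_; 1ℤ)
  import Data.Integer.Properties as ℤP
  open import Data.Integer.Tactic.RingSolver using (solve-∀)
  open import Data.Bool using (if_then_else_)
  open import Data.Empty using (⊥-elim)
  open import Data.Product using (Σ; _,_)
  open import Data.Sum using (inj₁; inj₂)
  open import Relation.Nullary using (Dec; yes; no; ¬_; does)
  open import Relation.Binary.PropositionalEquality hiding (J)
  open import Function using (_∘_)
  open import Data.List using (upTo)
  open import Data.List.Relation.Unary.Any using (any?)
  import Data.List.Relation.Unary.Any as Any

  legendre-mod : ∀ a b q → a % suc (suc q) ≡ b % suc (suc q) → legendre a q ≡ legendre b q
  legendre-mod a b q a≡b with suc (suc q) ∣? a | suc (suc q) ∣? b
  ... | yes _   | yes _   = refl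
  ... | yes p∣a | no p∤b = ⊥-elim (p∤b (m%n≡0⇒n∣m b _ (trans (sym a≡b) (n∣m⇒m%n≡0 a _ p∣a))))
  ... | no p∤a | yes p∣b = ⊥-elim (p∤a (m%n≡0⇒n∣m a _ (trans a≡b (n∣m⇒m%n≡0 b _ p∣b))))
  ... | no _    | no _
    with any? (λ y → (y ℕ.* y) % suc (suc q) ℕ.≟ a % suc (suc q)) (upTo (suc (suc q)))
       | any? (λ y → (y ℕ.* y) % suc (suc q) ℕ.≟ b % suc (suc q)) (upTo (suc (suc q)))
  ...   | yes _        | yes _        = refl
  ...   | no _         | no _         = refl
  ...   | yes a-square | no ¬b-square = ⊥-elim (¬b-square (Any.map (λ e → trans e a≡b) a-square))
  ...   | no ¬a-square | yes b-square = ⊥-elim (¬a-square (Any.map (λ e → trans e (sym a≡b)) b-square))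

  valFuel-zero : ∀ fuel q m → ¬ suc (suc q) ∣ m → valFuel fuel q m ≡ 0
  valFuel-zero zero       q m       _   = refl
  valFuel-zero (suc fuel) q zero    _   = refl
  valFuel-zero (suc fuel) q (suc m) p∤m with suc (suc q) ∣? suc m
  ... | yes p∣m = ⊥-elim (p∤m p∣m)
  ... | no _    = refl

  val-zero : ∀ q n → ¬ suc (suc q) ∣ n → val q n ≡ 0
  val-zero q n = valFuel-zero n q n

  val-one : ∀ q n → suc (suc q) ∣ n → ¬ suc (suc q) ∣ (n / suc (suc q)) → val q n ≡ 1
  val-one q zero    _   p∤n/p = ⊥-elim (p∤n/p (divides 0 refl))
  val-one q (suc n) p∣n p∤n/p with suc (suc q) ∣? suc n
  ... | yes _   = cong suc (valFuel-zero n q (suc n / suc (suc q)) p∤n/p)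
  ... | no p∤n = ⊥-elim (p∤n p∣n)

  factor : ℕ → ℕ → ℕ → ℤ
  factor a n q = if does (prime? (suc (suc q))) then legendre a q ^ val q n else 1ℤ

  prodBelow : ℕ → (ℕ → ℤ) → ℤ
  prodBelow zero    f = 1ℤ
  prodBelow (suc q) f = f q * prodBelow q f

  jacobi-product : ∀ a n Q → jacobiUpTo a n Q ≡ prodBelow Q (factor a n)
  jacobi-product a n zero    = refl
  jacobi-product a n (suc Q) = cong (factor a n Q *_) (jacobi-product a n Q)

  prodBelow-cong : ∀ Q {f g : ℕ → ℤ} → (∀ q → q < Q → f q ≡ g q) → prodBelow Q f ≡ prodBelow Q g
  prodBelow-cong zero    f≡g = refl
  prodBelow-cong (suc Q) f≡g =
    cong₂ _*_ (f≡g Q (ℕP.n<1+n Q)) (prodBelow-cong Q (λ q q<Q → f≡g q (ℕP.m<n⇒m<1+n q<Q)))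

  prodBelow-extract : ∀ Q (f g : ℕ → ℤ) q₀ → q₀ < Q → g q₀ ≡ 1ℤ → (∀ q → q ≢ q₀ → g q ≡ f q) →
    prodBelow Q f ≡ f q₀ * prodBelow Q g
  prodBelow-extract (suc Q) f g q₀ q₀<1+Q g₀≡1 g≡f with Q ℕ.≟ q₀
  ... | yes refl = cong (f Q *_) (begin
    prodBelow Q f          ≡⟨ prodBelow-cong Q (λ q q<Q → sym (g≡f q (ℕP.<⇒≢ q<Q))) ⟩
    prodBelow Q g          ≡⟨ ℤP.*-identityˡ (prodBelow Q g) ⟨
    1ℤ * prodBelow Q g     ≡⟨ cong (_* prodBelow Q g) g₀≡1 ⟨
    g Q * prodBelow Q g    ∎)
    where open ≡-Reasoning
  ... | no Q≢q₀ = begin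
    f Q * prodBelow Q f                  ≡⟨ cong (f Q *_) (prodBelow-extract Q f g q₀ q₀<Q g₀≡1 g≡f) ⟩
    f Q * (f q₀ * prodBelow Q g)         ≡⟨ swap (f Q) (f q₀) (prodBelow Q g) ⟩
    f q₀ * (f Q * prodBelow Q g)         ≡⟨ cong (λ x → f q₀ * (x * prodBelow Q g)) (g≡f Q Q≢q₀) ⟨
    f q₀ * (g Q * prodBelow Q g)         ∎
    where
    open ≡-Reasoning
    q₀<Q : q₀ < Q
    q₀<Q = ℕP.≤∧≢⇒< (ℕP.≤-pred q₀<1+Q) (Q≢q₀ ∘ sym)
    swap : ∀ a b c → a * (b * c) ≡ b * (a * c)
    swap = solve-∀

  if-yes : ∀ {P : Set} (d : Dec P) {x y : ℤ} → P → (if does d then x else y) ≡ x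
  if-yes (yes _) _ = refl
  if-yes (no ¬p) p = ⊥-elim (¬p p)

  if-cong : ∀ {P : Set} (d : Dec P) {x x′ y : ℤ} → (P → x ≡ x′) → (if does d then x else y) ≡ (if does d then x′ else y)
  if-cong (yes p) x≡x′ = x≡x′ p
  if-cong (no _)  _    = refl

  factor-mod : ∀ a b n q → (Prime (suc (suc q)) → suc (suc q) ∣ n → a % suc (suc q) ≡ b % suc (suc q)) →
    factor a n q ≡ factor b n q
  factor-mod a b n q a≡b = if-cong (prime? (suc (suc q))) same-power
    where
    same-power : Prime (suc (suc q)) → legendre a q ^ val q n ≡ legendre b q ^ val q n
    same-power p-prime with suc (suc q) ∣? n
    ... | yes p∣n = cong (_^ val q n) (legendre-mod a b q (a≡b p-prime p∣n))
    ... | no p∤n rewrite val-zero q n p∤n = refl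

  J-mod : ∀ a b n → (∀ q → Prime (suc (suc q)) → suc (suc q) ∣ n → a % suc (suc q) ≡ b % suc (suc q)) →
    J a n ≡ J b n
  J-mod a b n a≡b = begin
    J a n                                  ≡⟨ jacobi-product a n (n ∸ 1) ⟩
    prodBelow (n ∸ 1) (factor a n)         ≡⟨ prodBelow-cong (n ∸ 1) (λ q _ → factor-mod a b n q (a≡b q)) ⟩
    prodBelow (n ∸ 1) (factor b n)         ≡⟨ jacobi-product b n (n ∸ 1) ⟨
    J b n                                  ∎
    where open ≡-Reasoning

  -- If p = q₀ + 2 is a prime with p ∥ n and r = n / p, then along a progression
  -- s + k r the Jacobi symbol J(·, n) is the Legendre symbol modulo p times a
  -- constant: every other prime factor of n divides r, so the other factors
  -- do not depend on k.
  J-progression : ∀ n q₀ → Prime (suc (suc q₀)) → suc (suc q₀) ∣ n → ¬ suc (suc q₀) ∣ (n / suc (suc q₀)) →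
    ∀ s → Σ ℤ λ c → ∀ k → J (s ℕ.+ k ℕ.* (n / suc (suc q₀))) n ≡ legendre (s ℕ.+ k ℕ.* (n / suc (suc q₀))) q₀ * c
  J-progression n q₀ p-prime p∣n p∤r s = prodBelow (n ∸ 1) rest , λ k → begin
    J (s ℕ.+ k ℕ.* r) n                                          ≡⟨ jacobi-product (s ℕ.+ k ℕ.* r) n (n ∸ 1) ⟩
    prodBelow (n ∸ 1) (factor (s ℕ.+ k ℕ.* r) n)                 ≡⟨ prodBelow-extract (n ∸ 1) _ rest q₀ q₀<n-1 rest-q₀ (rest-other k) ⟩
    factor (s ℕ.+ k ℕ.* r) n q₀ * prodBelow (n ∸ 1) rest         ≡⟨ cong (_* prodBelow (n ∸ 1) rest) (p-factor k) ⟩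
    legendre (s ℕ.+ k ℕ.* r) q₀ * prodBelow (n ∸ 1) rest         ∎
    where
    open ≡-Reasoning
    p r : ℕ
    p = suc (suc q₀)
    r = n / p
    rest : ℕ → ℤ
    rest q with q ℕ.≟ q₀
    ... | yes _ = 1ℤ
    ... | no _  = factor s n q
    rest-q₀ : rest q₀ ≡ 1ℤ
    rest-q₀ with q₀ ℕ.≟ q₀
    ... | yes _  = refl
    ... | no q₀≢q₀ = ⊥-elim (q₀≢q₀ refl)
    n≡r*p : n ≡ r ℕ.* p
    n≡r*p = sym (m/n*n≡m p∣n)
    other-divides-r : ∀ q → q ≢ q₀ → Prime (suc (suc q)) → suc (suc q) ∣ n → suc (suc q) ∣ r
    other-divides-r q q≢q₀ q-prime q∣n with euclidsLemma r p q-prime (subst (suc (suc q) ∣_) n≡r*p q∣n)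
    ... | inj₁ q∣r = q∣r
    ... | inj₂ q∣p with prime⇒irreducible p-prime q∣p
    ...   | inj₁ ()
    ...   | inj₂ q+2≡p = ⊥-elim (q≢q₀ (ℕP.suc-injective (ℕP.suc-injective q+2≡p)))
    rest-other : ∀ k q → q ≢ q₀ → rest q ≡ factor (s ℕ.+ k ℕ.* r) n q
    rest-other k q q≢q₀ with q ℕ.≟ q₀
    ... | yes q≡q₀ = ⊥-elim (q≢q₀ q≡q₀)
    ... | no _     = factor-mod s (s ℕ.+ k ℕ.* r) n q (λ q-prime q∣n →
                       sym (%-remove-+ʳ s (∣n⇒∣m*n k (other-divides-r q q≢q₀ q-prime q∣n))))
    p-factor : ∀ k → factor (s ℕ.+ k ℕ.* r) n q₀ ≡ legendre (s ℕ.+ k ℕ.* r) q₀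
    p-factor k = begin
      factor (s ℕ.+ k ℕ.* r) n q₀                  ≡⟨ if-yes (prime? p) p-prime ⟩
      legendre (s ℕ.+ k ℕ.* r) q₀ ^ val q₀ n       ≡⟨ cong (legendre (s ℕ.+ k ℕ.* r) q₀ ^_) (val-one q₀ n p∣n p∤r) ⟩
      legendre (s ℕ.+ k ℕ.* r) q₀ ^ 1              ≡⟨ ℤP.*-identityʳ _ ⟩
      legendre (s ℕ.+ k ℕ.* r) q₀                  ∎
    q₀<n-1 : q₀ < n ∸ 1
    q₀<n-1 = ℕP.∸-monoˡ-≤ 1 (∣⇒≤ {{ℕ.≢-nonZero n≢0}} p∣n)
      where
      n≢0 : n ≢ 0
      n≢0 refl = p∤r (divides 0 refl)


module Annihilators where

  open IntegerSums
  open HankelReduction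
  open Counting
  open QuadraticResidues
  open JacobiSymbol
  open import Data.Nat as ℕ using (ℕ; zero; suc; _<_; _≤_; z≤n; s≤s)
  import Data.Nat.Properties as ℕP
  open import Data.Integer as ℤ using (ℤ; -_; _*_; _+_; 0ℤ; 1ℤ)
  import Data.Integer.Properties as ℤP
  open import Data.Integer.Tactic.RingSolver using (solve-∀)
  open import Data.Fin as Fin using (Fin; zero; suc; toℕ)
  import Data.Fin.Properties as FinP
  open import Relation.Binary.PropositionalEquality hiding (J)
  open import Function using (_∘_)
  open import Data.Sum using (inj₁; inj₂)
  open import Data.Empty using (⊥-elim)
  open import Data.Product using (proj₁; proj₂)
  open import Data.Nat.DivMod using (_%_; _/_; m/n*n≡m; %-remove-+ʳ; m<n⇒m%n≡m; [m+kn]%n≡m%n)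
  open import Data.Nat.Divisibility using (_∣_; divides; ∣⇒≤; ∣1⇒≡1; ∣m+n∣m⇒∣n; m%n≡0⇒n∣m; n∣m⇒m%n≡0)
  open import Relation.Nullary using (¬_)
  import Algebra.Properties.Semiring.Sum ℕP.+-*-semiring as ℕΣ
  open import Algebra.Properties.AbelianGroup ℤP.+-0-abelianGroup using (identityˡ-unique)
  open import Data.Nat.Primality using (Prime; euclidsLemma; prime⇒irreducible)
  open import Algebra.Properties.Semiring.Sum ℤP.+-*-semiring
    using (sum; sum-cong-≗; sum-syntax; ∑-distrib-+; *-distribʳ-sum)

  -- Summed over p consecutive terms of an arithmetic progression whose
  -- difference is prime to p, the Legendre symbol mod p vanishes: adding 1 to
  -- each term counts the p pairs (k , y) with y² ≡ s + k r (mod p).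
  legendre-progression-sum : ∀ q₀ → Prime (suc (suc q₀)) → q₀ ≢ 0 → ∀ s r → ¬ suc (suc q₀) ∣ r →
    ∑[ k < suc (suc q₀) ] legendre (s ℕ.+ toℕ k ℕ.* r) q₀ ≡ 0ℤ
  legendre-progression-sum q₀ p-prime p≢2 s r p∤r = identityˡ-unique (sum L) (ℤ.+ p) (begin
    sum L + ℤ.+ p                                         ≡⟨ cong (λ z → sum L + z) (sum-ones p) ⟨
    sum L + ∑[ _ < p ] 1ℤ                                 ≡⟨ ∑-distrib-+ L (λ _ → 1ℤ) ⟨
    ∑[ k < p ] (L k + 1ℤ)                                 ≡⟨ sum-cong-≗ {p} (λ k → legendre-count (s ℕ.+ toℕ k ℕ.* r)) ⟩
    ∑[ k < p ] (ℤ.+ roots (s ℕ.+ toℕ k ℕ.* r))            ≡⟨ sum-pos {p} (λ k → roots (s ℕ.+ toℕ k ℕ.* r)) ⟨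
    ℤ.+ (ℕΣ.sum (λ (k : Fin p) → roots (s ℕ.+ toℕ k ℕ.* r)))  ≡⟨ cong ℤ.+_ (progression-roots s r p∤r) ⟩
    ℤ.+ p                                                 ∎)
    where
    open ≡-Reasoning
    open OddPrime q₀ p-prime p≢2
    L : Fin p → ℤ
    L k = legendre (s ℕ.+ toℕ k ℕ.* r) q₀

  -- Case p² ∣ n.  Every prime factor of n divides m = n / p, so J(·, n) has
  -- period m, and w = δ₀ - δ_m annihilates its windows; here 2 ≤ m ≤ n - 2.
  H-vanishes-square-factor : ∀ N x q₀ → Prime (suc (suc q₀)) → suc (suc q₀) ∣ suc (suc N) →
    suc (suc q₀) ∣ (suc (suc N) / suc (suc q₀)) → H (suc (suc N)) x ≡ 0ℤ
  H-vanishes-square-factor N x q₀ p-prime p∣n p∣m =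
    H-vanishes-if-annihilated N x w w₀≡1 w₁≡0 wₙ≡0 window
    where
    n p m : ℕ
    n = suc (suc N)
    p = suc (suc q₀)
    m = n / p
    n≡m*p : n ≡ m ℕ.* p
    n≡m*p = sym (m/n*n≡m p∣n)
    m≢0 : m ≢ 0
    m≢0 m≡0 with trans n≡m*p (cong (ℕ._* p) m≡0)
    ... | ()
    2≤m : 2 ≤ m
    2≤m = ℕP.≤-trans (s≤s (s≤s z≤n)) (∣⇒≤ {{ℕ.≢-nonZero m≢0}} p∣m)
    m≤N : m ≤ N
    m≤N = ℕP.≤-pred (ℕP.≤-pred (begin
      suc (suc m)     ≤⟨ ℕP.+-monoˡ-≤ m 2≤m ⟩
      m ℕ.+ m         ≡⟨ trans (cong (λ e → m ℕ.+ e) (sym (ℕP.+-identityʳ m))) (ℕP.*-comm 2 m) ⟩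
      m ℕ.* 2         ≤⟨ ℕP.*-monoʳ-≤ m (s≤s (s≤s z≤n)) ⟩
      m ℕ.* p         ≡⟨ n≡m*p ⟨
      n               ∎))
      where open ℕP.≤-Reasoning
    w : ℕ → ℤ
    w t = ℤ.+ δ t 0 + - ℤ.+ δ t m
    w₀≡1 : w 0 ≡ 1ℤ
    w₀≡1 rewrite δ-≢ (m≢0 ∘ sym) = refl
    w₁≡0 : w 1 ≡ 0ℤ
    w₁≡0 rewrite δ-≢ {1} {m} (λ 1≡m → ℕP.<-irrefl 1≡m 2≤m) = refl
    wₙ≡0 : w (suc N) ≡ 0ℤ
    wₙ≡0 rewrite δ-≢ {suc N} {m} (λ N+1≡m → ℕP.<-irrefl (sym N+1≡m) (s≤s m≤N)) = refl
    period : ∀ s → J (s ℕ.+ m) n ≡ J s n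
    period s = J-mod (s ℕ.+ m) s n (λ q q-prime q∣n → %-remove-+ʳ s (divides-m q q-prime q∣n))
      where
      divides-m : ∀ q → Prime (suc (suc q)) → suc (suc q) ∣ n → suc (suc q) ∣ m
      divides-m q q-prime q∣n with euclidsLemma m p q-prime (subst (suc (suc q) ∣_) n≡m*p q∣n)
      ... | inj₁ q∣m = q∣m
      ... | inj₂ q∣p with prime⇒irreducible p-prime q∣p
      ...   | inj₁ ()
      ...   | inj₂ q+2≡p = subst (_∣ m) (sym q+2≡p) p∣m
    window : ∀ s → ∑[ t < suc N ] (w (toℕ t) * J (s ℕ.+ toℕ t) n) ≡ 0ℤ
    window s = begin
      ∑[ t < suc N ] (w (toℕ t) * g (toℕ t))
        ≡⟨ sum-cong-≗ {suc N} (λ t → expand (ℤ.+ δ (toℕ t) 0) (ℤ.+ δ (toℕ t) m) (g (toℕ t))) ⟩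
      ∑[ t < suc N ] (ℤ.+ δ (toℕ t) 0 * g (toℕ t) + - (ℤ.+ δ (toℕ t) m * g (toℕ t)))
        ≡⟨ ∑-distrib-+ {suc N} (λ t → ℤ.+ δ (toℕ t) 0 * g (toℕ t)) (λ t → - (ℤ.+ δ (toℕ t) m * g (toℕ t))) ⟩
      ∑[ t < suc N ] (ℤ.+ δ (toℕ t) 0 * g (toℕ t)) + ∑[ t < suc N ] (- (ℤ.+ δ (toℕ t) m * g (toℕ t)))
        ≡⟨ cong (λ z → ∑[ t < suc N ] (ℤ.+ δ (toℕ t) 0 * g (toℕ t)) + z) (sum-neg (λ (t : Fin (suc N)) → ℤ.+ δ (toℕ t) m * g (toℕ t))) ⟩
      ∑[ t < suc N ] (ℤ.+ δ (toℕ t) 0 * g (toℕ t)) + - ∑[ t < suc N ] (ℤ.+ δ (toℕ t) m * g (toℕ t))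
        ≡⟨ cong₂ (λ a b → a + - b) (sum-pick (suc N) 0 g (s≤s z≤n)) (sum-pick (suc N) m g (s≤s m≤N)) ⟩
      g 0 + - g m
        ≡⟨ cong (λ a → g 0 + - a) (trans (period s) (cong (λ a → J a n) (sym (ℕP.+-identityʳ s)))) ⟩
      g 0 + - g 0
        ≡⟨ ℤP.+-inverseʳ (g 0) ⟩
      0ℤ  ∎
      where
      open ≡-Reasoning
      g : ℕ → ℤ
      g t = J (s ℕ.+ t) n
      expand : ∀ a b c → (a + - b) * c ≡ a * c + - (b * c)
      expand = solve-∀

  -- Case p ∥ n with p odd and r = n / p > 1.  The indicator w of the multiples
  -- of r annihilates the windows of J(·, n): a window of length n - 1, padded
  -- to length n = p r, splits into p blocks of length r, and picks the terms
  -- J(s + k r), whose sum vanishes by J-progression and legendre-progression-sum.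
  H-vanishes-simple-factor : ∀ N x q₀ → Prime (suc (suc q₀)) → q₀ ≢ 0 → suc (suc q₀) ∣ suc (suc N) →
    ¬ suc (suc q₀) ∣ (suc (suc N) / suc (suc q₀)) → suc (suc N) / suc (suc q₀) ≢ 1 → H (suc (suc N)) x ≡ 0ℤ
  H-vanishes-simple-factor N x q₀ p-prime p≢2 p∣n p∤r r≢1 =
    H-vanishes-if-annihilated N x w w₀≡1 w₁≡0 wₙ≡0 window
    where
    n p r : ℕ
    n = suc (suc N)
    p = suc (suc q₀)
    r = n / p
    n≡r*p : n ≡ r ℕ.* p
    n≡r*p = sym (m/n*n≡m p∣n)
    r≢0 : r ≢ 0
    r≢0 r≡0 with trans n≡r*p (cong (ℕ._* p) r≡0)
    ... | ()
    instance
      r-nonZero : ℕ.NonZero r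
      r-nonZero = ℕ.≢-nonZero r≢0
    1<r : 1 < r
    1<r = ≢0∧≢1⇒>1 r r≢0 r≢1
      where
      ≢0∧≢1⇒>1 : ∀ m → m ≢ 0 → m ≢ 1 → 1 < m
      ≢0∧≢1⇒>1 zero          m≢0 _   = ⊥-elim (m≢0 refl)
      ≢0∧≢1⇒>1 (suc zero)    _   m≢1 = ⊥-elim (m≢1 refl)
      ≢0∧≢1⇒>1 (suc (suc m)) _   _   = s≤s (s≤s z≤n)
    -- r divides n = (n - 1) + 1, so it does not divide n - 1.
    r∤N+1 : (suc N) % r ≢ 0
    r∤N+1 N+1%r≡0 = r≢1 (∣1⇒≡1 (∣m+n∣m⇒∣n r∣n (m%n≡0⇒n∣m (suc N) r N+1%r≡0)))
      where
      r∣n : r ∣ suc N ℕ.+ 1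
      r∣n = divides p (trans (ℕP.+-comm (suc N) 1) (trans n≡r*p (ℕP.*-comm r p)))
    w : ℕ → ℤ
    w t = ℤ.+ δ (t % r) 0
    w₀≡1 : w 0 ≡ 1ℤ
    w₀≡1 rewrite n∣m⇒m%n≡0 0 r (divides 0 refl) = refl
    w₁≡0 : w 1 ≡ 0ℤ
    w₁≡0 rewrite m<n⇒m%n≡m 1<r = refl
    wₙ≡0 : w (suc N) ≡ 0ℤ
    wₙ≡0 rewrite δ-≢ {(suc N) % r} {0} r∤N+1 = refl
    window : ∀ s → ∑[ t < suc N ] (w (toℕ t) * J (s ℕ.+ toℕ t) n) ≡ 0ℤ
    window s = begin
      ∑[ t < suc N ] h (toℕ t)                     ≡⟨ ℤP.+-identityʳ _ ⟨
      ∑[ t < suc N ] h (toℕ t) + 0ℤ                ≡⟨ cong (λ z → ∑[ t < suc N ] h (toℕ t) + z) h-last ⟨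
      ∑[ t < suc N ] h (toℕ t) + h (suc N)         ≡⟨ sum-last (suc N) h ⟨
      ∑[ t < n ] h (toℕ t)                         ≡⟨ cong (λ l → ∑[ t < l ] h (toℕ t)) (trans n≡r*p (ℕP.*-comm r p)) ⟩
      ∑[ t < p ℕ.* r ] h (toℕ t)                   ≡⟨ sum-blocks p r h ⟩
      ∑[ k < p ] ∑[ a < r ] h (toℕ k ℕ.* r ℕ.+ toℕ a)  ≡⟨ sum-cong-≗ {p} (λ k → block (toℕ k)) ⟩
      ∑[ k < p ] J (s ℕ.+ toℕ k ℕ.* r) n           ≡⟨ sum-cong-≗ {p} (λ k → proj₂ progression (toℕ k)) ⟩
      ∑[ k < p ] (legendre (s ℕ.+ toℕ k ℕ.* r) q₀ * c)  ≡⟨ *-distribʳ-sum {p} c (λ k → legendre (s ℕ.+ toℕ k ℕ.* r) q₀) ⟨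
      (∑[ k < p ] legendre (s ℕ.+ toℕ k ℕ.* r) q₀) * c  ≡⟨ cong (_* c) (legendre-progression-sum q₀ p-prime p≢2 s r p∤r) ⟩
      0ℤ * c                                       ≡⟨⟩
      0ℤ                                           ∎
      where
      open ≡-Reasoning
      h : ℕ → ℤ
      h t = w t * J (s ℕ.+ t) n
      h-last : h (suc N) ≡ 0ℤ
      h-last = cong (_* J (s ℕ.+ suc N) n) wₙ≡0
      progression = J-progression n q₀ p-prime p∣n p∤r s
      c : ℤ
      c = proj₁ progression
      -- Only the first term of each block survives.
      block : ∀ k → ∑[ a < r ] h (k ℕ.* r ℕ.+ toℕ a) ≡ J (s ℕ.+ k ℕ.* r) n
      block k = begin
        ∑[ a < r ] h (k ℕ.* r ℕ.+ toℕ a)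
          ≡⟨ sum-cong-≗ {r} (λ a → cong (λ b → ℤ.+ δ b 0 * g (toℕ a)) (position (toℕ a) (FinP.toℕ<n a))) ⟩
        ∑[ a < r ] (ℤ.+ δ (toℕ a) 0 * g (toℕ a))
          ≡⟨ sum-pick r 0 g (ℕP.<-trans (s≤s z≤n) 1<r) ⟩
        g 0
          ≡⟨ cong (λ b → J (s ℕ.+ b) n) (ℕP.+-identityʳ (k ℕ.* r)) ⟩
        J (s ℕ.+ k ℕ.* r) n  ∎
        where
        g : ℕ → ℤ
        g a = J (s ℕ.+ (k ℕ.* r ℕ.+ a)) n
        position : ∀ a → a < r → (k ℕ.* r ℕ.+ a) % r ≡ a
        position a a<r = trans (cong (_% r) (ℕP.+-comm (k ℕ.* r) a)) (trans ([m+kn]%n≡m%n a k r) (m<n⇒m%n≡m a<r))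


module PrimeFactorCases where

  open Annihilators
  import Data.Nat as ℕ
  import Data.Nat.Properties as ℕP
  open import Data.Nat.DivMod using (_/_; m/n*n≡m)
  open import Data.Nat.Divisibility using (_∣?_)
  open import Data.Nat.Primality using (Prime; composite⇒¬prime; prime⇒nonTrivial)
  open import Data.Nat.Primality.Factorisation using (factorise; PrimeFactorisation)
  open import Data.Nat.ListAction using (product)
  open import Data.List using ([]; _∷_)
  open import Data.List.Relation.Unary.All using (All; []; _∷_)
  open import Data.Product using (Σ; _×_)
  open import Relation.Nullary using (Dec; yes; no)
  open import Relation.Binary.PropositionalEquality

  prime-factor : ∀ n .{{_ : ℕ.NonZero n}} → n ≢ 1 → Σ ℕ λ p → Prime p × p ∣ n
  prime-factor n n≢1 = first (PrimeFactorisation.factors f) (PrimeFactorisation.isFactorisation f)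
                             (PrimeFactorisation.factorsPrime f)
    where
    f = factorise n
    first : ∀ ps → n ≡ product ps → All Prime ps → Σ ℕ λ p → Prime p × p ∣ n
    first []       n≡1     _             = ⊥-elim (n≢1 n≡1)
    first (p ∷ ps) n≡p*ps (p-prime ∷ _) = p , p-prime , divides (product ps) (trans n≡p*ps (ℕP.*-comm p (product ps)))

  H-vanishes-at-prime-factor : ∀ N x p → Prime p → ¬ 2 ∣ p → p ∣ suc (suc N) → Composite (suc (suc N)) →
    H (suc (suc N)) x ≡ + 0
  H-vanishes-at-prime-factor N x 0 p-prime _ _ _ = ⊥-elim (ℕ.NonTrivial.nonTrivial (prime⇒nonTrivial p-prime))
  H-vanishes-at-prime-factor N x 1 p-prime _ _ _ = ⊥-elim (ℕ.nonTrivial⇒≢1 {{prime⇒nonTrivial p-prime}} refl)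
  H-vanishes-at-prime-factor N x 2 _ p-odd _ _ = ⊥-elim (p-odd (divides 1 refl))
  H-vanishes-at-prime-factor N x (suc (suc (suc q))) p-prime _ p∣n n-composite =
    by-multiplicity (suc (suc (suc q)) ∣? (suc (suc N) / suc (suc (suc q))))
    where
    p : ℕ
    p = suc (suc (suc q))
    n/p≢1 : suc (suc N) / p ≢ 1
    n/p≢1 n/p≡1 = composite⇒¬prime n-composite (subst Prime (sym n≡p) p-prime)
      where
      n≡p : suc (suc N) ≡ p
      n≡p = trans (sym (m/n*n≡m p∣n)) (trans (cong (ℕ._* p) n/p≡1) (ℕP.*-identityˡ p))
    by-multiplicity : Dec (p ∣ suc (suc N) / p) → H (suc (suc N)) x ≡ + 0
    by-multiplicity (yes p∣n/p) = H-vanishes-square-factor N x (suc q) p-prime p∣n p∣n/p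
    by-multiplicity (no  p∤n/p) = H-vanishes-simple-factor N x (suc q) p-prime (λ ()) p∣n p∤n/p n/p≢1


open PrimeFactorCases

lemma2 : (n : ℕ) → ¬ (2 ∣ n) → Composite n → (x : ℤ) → H n x ≡ + 0
lemma2 zero          n-odd _           x = ⊥-elim (n-odd (divides 0 refl))
lemma2 (suc zero)    _     n-composite x = ⊥-elim (nonTrivial⇒≢1 {{composite⇒nonTrivial n-composite}} refl)
lemma2 (suc (suc N)) n-odd n-composite x =
  let p , p-prime , p∣n = prime-factor (suc (suc N)) (λ ())
  in  H-vanishes-at-prime-factor N x p p-prime (λ 2∣p → n-odd (∣-trans 2∣p p∣n)) p∣n n-composite
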